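{- Let $(P,\le)$ be a join-semilattice and $n\in\omega$. The following are equivalent: (1) every element of $P$ has a lower covering of size at most $n$; (2) $P$ is $\overline{(n+1)}^{\top}$-free.
   Context: An ideal of a join-semilattice is a nonempty downward closed subset closed under binary joins. A lower covering of $x\in P$ is a set $\mathcal I$ of ideals of $P$ with $\{y\in P: y<x\}=\bigcup\mathcal I$. For $k\in\omega$, $\overline{k}^{\top}$ is the join-semilattice on $\{0,\dots,k-1\}\sqcup\{\mathbf 1\}$ with $x\vee y=\mathbf 1$ for all distinct $x,y$; $P$ is $\overline{k}^{\top}$-free if it has no join-subsemilattice isomorphic to $\overline{k}^{\top}$ (equivalently, no join-embedding of $\overline{k}^{\top}$ into $P$). -}

module Defs where

open import Level using (0ℓ)
open import Data.Nat using (ℕ; _≤_)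
open import Data.Fin using (Fin; _≟_)
open import Data.Product using (Σ; ∃; ∃-syntax; _×_)
open import Relation.Nullary using (¬_; yes; no)
open import Relation.Binary.PropositionalEquality using (_≡_)
open import Relation.Binary.Lattice.Bundles using (JoinSemilattice)

data KTop (k : ℕ) : Set where
  elem : Fin k → KTop k
  top  : KTop k

_⊔ₖ_ : ∀ {k} → KTop k → KTop k → KTop k
elem i ⊔ₖ elem j with i ≟ j
... | yes _ = elem i
... | no  _ = top
elem i ⊔ₖ top = top
top ⊔ₖ _ = top

module _ (P : JoinSemilattice 0ℓ 0ℓ 0ℓ) where
  open JoinSemilattice P renaming (_≤_ to _≼_)

  _≺_ : Carrier → Carrier → Set
  y ≺ x = (y ≼ x) × ¬ (y ≈ x)

  IsIdeal : (Carrier → Set) → Set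
  IsIdeal I = (∃[ x ] I x)
            × (∀ x y → y ≼ x → I x → I y)
            × (∀ x y → I x → I y → I (x ∨ y))

  IsLowerCovering : (x : Carrier) (m : ℕ) → (Fin m → Carrier → Set) → Set
  IsLowerCovering x m I =
    (∀ i → IsIdeal (I i))
    × (∀ y → (y ≺ x → ∃[ i ] I i y) × (∃[ i ] I i y → y ≺ x))

  HasLowerCoveringOfSize≤ : ℕ → Carrier → Set₁
  HasLowerCoveringOfSize≤ n x =
    Σ ℕ λ m → m ≤ n × Σ (Fin m → Carrier → Set) λ I → IsLowerCovering x m I

  -- injective join-homomorphism k̄^⊤ → P (= join-subsemilattice isomorphic to k̄^⊤)
  JoinEmbedding : ℕ → Set
  JoinEmbedding k = Σ (KTop k → Carrier) λ f →
      (∀ a b → f a ≈ f b → a ≡ b)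
    × (∀ a b → f (a ⊔ₖ b) ≈ (f a ∨ f b))

  KTop-free : ℕ → Set
  KTop-free k = ¬ JoinEmbedding k

{-# OPTIONS --safe #-}
module Submission where

open import Defs
open import Level using (0ℓ)
open import Data.Nat using (ℕ; suc)
open import Function.Bundles using (_⇔_)
open import Axiom.ExcludedMiddle using (ExcludedMiddle)
open import Relation.Binary.Lattice.Bundles using (JoinSemilattice)

import Data.Nat as ℕ
open import Data.Nat.Properties using (≤-refl; m≤n⇒m≤1+n; <⇒≱; ≮⇒≥)
open import Data.Fin as Fin using (Fin; _≟_)
open import Data.Fin.Properties using (pigeonhole; <⇒≢; ¬∀⟶∃¬)
open import Data.Product using (∃-syntax; _×_; _,_; proj₁; proj₂)
open import Data.Vec.Functional using (Vector; _∷_; updateAt)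
open import Data.Vec.Functional.Properties using (updateAt-updates; updateAt-minimal)
open import Function.Base using (_∘_)
open import Function.Bundles using (mk⇔)
open import Relation.Nullary using (¬_; Dec; yes; no; contradiction)
open import Relation.Binary.PropositionalEquality as ≡ using (_≡_; _≢_; cong; subst)
import Relation.Binary.Construct.NonStrictToStrict as NonStrictToStrict
import Relation.Binary.Lattice.Properties.JoinSemilattice as JoinSemilatticeProperties

-- Call k elements strictly below x "independent" when any two distinct ones join to x; a join-embedding
-- of k̄^⊤ is exactly such a family together with its top x.  A lower covering of x by m ideals admits no
-- independent family of size m + 1 below x: by pigeonhole two of its members share an ideal, which then
-- contains their join x.  Conversely take an independent family a₀,…,a_{k-1} below x that cannot be
-- extended (k ≤ n since there is no embedding of (n+1)̄^⊤).  The sets {y : y ∨ aᵢ < x} cover {y : y < x},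
-- as an uncovered y would extend the family, and they are ideals: if y ∨ aᵢ and z ∨ aᵢ are below x but
-- y ∨ z ∨ aᵢ = x, replacing aᵢ by z ∨ aᵢ and adding y ∨ aᵢ again extends the family.

updateAt-elim : ∀ {a p} {A : Set a} {n} (Q : Fin n → A → Set p) (xs : Vector A n) (i : Fin n) {f : A → A} →
                Q i (f (xs i)) → (∀ j → j ≢ i → Q j (xs j)) → ∀ j → Q j (updateAt xs i f j)
updateAt-elim Q xs i Qi Qj j with j ≟ i
... | yes ≡.refl = subst (Q i) (≡.sym (updateAt-updates i xs)) Qi
... | no  j≢i    = subst (Q j) (≡.sym (updateAt-minimal j i xs j≢i)) (Qj j j≢i)

threshold : ∀ {n} {Q : ℕ → Set} → (∀ k → Dec (Q k)) → Q 0 → ¬ Q (suc n) →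
           ∃[ k ] k ℕ.≤ n × Q k × ¬ Q (suc k)
threshold {ℕ.zero} Q? Q0 ¬Q1 = 0 , ℕ.z≤n , Q0 , ¬Q1
threshold {suc n}  Q? Q0 ¬Qn+2 with Q? (suc n)
... | yes Qn+1 = suc n , ≤-refl , Qn+1 , ¬Qn+2
... | no ¬Qn+1 with threshold Q? Q0 ¬Qn+1
...   | k , k≤n , Qk , ¬Qk+1 = k , m≤n⇒m≤1+n k≤n , Qk , ¬Qk+1

⊔ₖ-distinct : ∀ {k} {i j : Fin k} → i ≢ j → elem i ⊔ₖ elem j ≡ top
⊔ₖ-distinct {i = i} {j} i≢j with i ≟ j
... | yes i≡j = contradiction i≡j i≢j
... | no  _   = ≡.refl

module _ (P : JoinSemilattice 0ℓ 0ℓ 0ℓ) where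
  open JoinSemilattice P
  open JoinSemilatticeProperties P using (∨-monotonic; ∨-comm; ∨-idempotent; x≤y⇒x∨y≈y)
  open NonStrictToStrict _≈_ _≤_ using (_<_; <⇒≤; <⇒≉; ≤∧≉⇒<)

  ≤-<-trans : ∀ {a b c} → a ≤ b → b < c → a < c
  ≤-<-trans = NonStrictToStrict.≤-<-trans _≈_ _≤_ trans antisym ≤-respˡ-≈

  record Independent (x : Carrier) (k : ℕ) : Set where
    field
      family : Vector Carrier k
      below  : ∀ i → family i < x
      joins  : ∀ {i j} → i ≢ j → family i ∨ family j ≈ x

  independent-empty : ∀ {x} → Independent x 0
  independent-empty = record { family = λ () ; below = λ () ; joins = λ {} }

  module _ {x k} (A : Independent x k) where
    open Independent A

    upper-bound-of-pair≈x : ∀ {c i j} → i ≢ j → family i ≤ c → family j ≤ c → c ≤ x → c ≈ x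
    upper-bound-of-pair≈x i≢j aᵢ≤c aⱼ≤c c≤x = antisym c≤x (trans (reflexive (Eq.sym (joins i≢j))) (∨-least aᵢ≤c aⱼ≤c))

    independent-raise : (b : Vector Carrier k) → (∀ i → family i ≤ b i) → (∀ i → b i < x) → Independent x k
    independent-raise b a≤b b<x = record
      { family = b
      ; below  = b<x
      ; joins  = λ {i} {j} i≢j → upper-bound-of-pair≈x i≢j
          (trans (a≤b i) (x≤x∨y _ _)) (trans (a≤b j) (y≤x∨y _ _)) (∨-least (<⇒≤ (b<x i)) (<⇒≤ (b<x j)))
      }

    independent-cons : ∀ {y} → y < x → (∀ i → y ∨ family i ≈ x) → Independent x (suc k)
    independent-cons {y} y<x y∨a≈x = record { family = y ∷ family ; below = below′ ; joins = joins′ }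
      where
      below′ : ∀ i → (y ∷ family) i < x
      below′ Fin.zero    = y<x
      below′ (Fin.suc i) = below i
      joins′ : ∀ {i j} → i ≢ j → (y ∷ family) i ∨ (y ∷ family) j ≈ x
      joins′ {Fin.zero}  {Fin.zero}  0≢0 = contradiction ≡.refl 0≢0
      joins′ {Fin.zero}  {Fin.suc j} _   = y∨a≈x j
      joins′ {Fin.suc i} {Fin.zero}  _   = Eq.trans (∨-comm _ _) (y∨a≈x i)
      joins′ {Fin.suc i} {Fin.suc j} i≢j = joins (i≢j ∘ cong Fin.suc)

    independent⇒joinEmbedding : JoinEmbedding P k
    independent⇒joinEmbedding = f , injective , homomorphic
      where
      f : KTop k → Carrier
      f (elem i) = family i
      f top      = x
      f≤x : ∀ u → f u ≤ x
      f≤x (elem i) = <⇒≤ (below i)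
      f≤x top      = refl
      injective : ∀ u v → f u ≈ f v → u ≡ v
      injective (elem i) (elem j) aᵢ≈aⱼ with i ≟ j
      ... | yes i≡j = cong elem i≡j
      ... | no  i≢j = contradiction (upper-bound-of-pair≈x i≢j refl (reflexive (Eq.sym aᵢ≈aⱼ)) (f≤x (elem i)))
                                    (<⇒≉ (below i))
      injective (elem i) top      aᵢ≈x = contradiction aᵢ≈x (<⇒≉ (below i))
      injective top      (elem j) x≈aⱼ = contradiction (Eq.sym x≈aⱼ) (<⇒≉ (below j))
      injective top      top      _    = ≡.refl
      homomorphic : ∀ u v → f (u ⊔ₖ v) ≈ f u ∨ f v
      homomorphic (elem i) (elem j) with i ≟ j
      ... | yes ≡.refl = Eq.sym (∨-idempotent _)
      ... | no  i≢j    = Eq.sym (joins i≢j)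
      homomorphic (elem i) top = Eq.sym (x≤y⇒x∨y≈y (f≤x (elem i)))
      homomorphic top      v   = Eq.sym (Eq.trans (∨-comm _ _) (x≤y⇒x∨y≈y (f≤x v)))

  joinEmbedding⇒independent : ∀ {k} → JoinEmbedding P k → ∃[ x ] Independent x k
  joinEmbedding⇒independent (f , injective , homomorphic) = f top , record
    { family = f ∘ elem
    ; below  = λ i → trans (x≤x∨y _ _) (reflexive (Eq.sym (homomorphic (elem i) top)))
                   , λ fᵢ≈f⊤ → elem≢top (injective _ _ fᵢ≈f⊤)
    ; joins  = λ i≢j → Eq.trans (Eq.sym (homomorphic _ _)) (reflexive′ (⊔ₖ-distinct i≢j))
    }
    where
    elem≢top : ∀ {i} → elem i ≢ top
    elem≢top ()
    reflexive′ : ∀ {u v} → u ≡ v → f u ≈ f v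
    reflexive′ ≡.refl = Eq.refl

  independent≤lowerCovering : ∀ {x k m I} → IsLowerCovering P x m I → Independent x k → k ℕ.≤ m
  independent≤lowerCovering {x} {k} {m} {I} (ideals , covers) A = ≮⇒≥ m≮k
    where
    open Independent A
    ideal-of : Fin k → Fin m
    ideal-of i = proj₁ (proj₁ (covers (family i)) (below i))
    in-ideal-of : ∀ i → I (ideal-of i) (family i)
    in-ideal-of i = proj₂ (proj₁ (covers (family i)) (below i))
    m≮k : ¬ m ℕ.< k
    m≮k m<k with pigeonhole m<k ideal-of
    ... | i , j , i<j , same = <⇒≉ (proj₂ (covers x) (ideal-of i , x∈I)) Eq.refl
      where
      downward : ∀ y z → z ≤ y → I (ideal-of i) y → I (ideal-of i) z
      downward = proj₁ (proj₂ (ideals (ideal-of i)))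
      ∨-closed : ∀ y z → I (ideal-of i) y → I (ideal-of i) z → I (ideal-of i) (y ∨ z)
      ∨-closed = proj₂ (proj₂ (ideals (ideal-of i)))
      aᵢ∨aⱼ∈I : I (ideal-of i) (family i ∨ family j)
      aᵢ∨aⱼ∈I = ∨-closed _ _ (in-ideal-of i) (subst (λ t → I t (family j)) (≡.sym same) (in-ideal-of j))
      x∈I : I (ideal-of i) x
      x∈I = downward _ _ (reflexive (Eq.sym (joins (<⇒≢ i<j)))) aᵢ∨aⱼ∈I

  JoinsBelow : Carrier → Carrier → Carrier → Set
  JoinsBelow x a y = y ∨ a < x

  joinsBelow-self : ∀ {x a} → a < x → JoinsBelow x a a
  joinsBelow-self a<x = ≤-<-trans (reflexive (∨-idempotent _)) a<x

  joinsBelow-downward : ∀ {x a} y z → z ≤ y → JoinsBelow x a y → JoinsBelow x a z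
  joinsBelow-downward _ _ z≤y = ≤-<-trans (∨-monotonic z≤y refl)

  module _ {x k} (A : Independent x k) (maximal : ¬ Independent x (suc k)) where
    open Independent A

    joinsBelow-∨-closed : ∀ i y z → JoinsBelow x (family i) y → JoinsBelow x (family i) z →
                          JoinsBelow x (family i) (y ∨ z)
    joinsBelow-∨-closed i y z u<x v<x = ≤∧≉⇒< (trans y∨z∨a≤u∨v u∨v≤x) (maximal ∘ extension)
      where
      a u v : Carrier
      a = family i
      u = y ∨ a
      v = z ∨ a
      u∨v≤x : u ∨ v ≤ x
      u∨v≤x = ∨-least (<⇒≤ u<x) (<⇒≤ v<x)
      y∨z∨a≤u∨v : (y ∨ z) ∨ a ≤ u ∨ v
      y∨z∨a≤u∨v = ∨-least (∨-monotonic (x≤x∨y y a) (x≤x∨y z a)) (trans (y≤x∨y y a) (x≤x∨y u v))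
      raised : Independent x k
      raised = independent-raise A (updateAt family i (z ∨_))
        (updateAt-elim (λ j c → family j ≤ c) family i (y≤x∨y z a) (λ _ _ → refl))
        (updateAt-elim (λ _ c → c < x) family i v<x (λ j _ → below j))
      extension : (y ∨ z) ∨ a ≈ x → Independent x (suc k)
      extension y∨z∨a≈x = independent-cons raised u<x
        (updateAt-elim (λ _ c → u ∨ c ≈ x) family i
          (antisym u∨v≤x (trans (reflexive (Eq.sym y∨z∨a≈x)) y∨z∨a≤u∨v))
          (λ j j≢i → upper-bound-of-pair≈x A (j≢i ∘ ≡.sym) (trans (y≤x∨y y a) (x≤x∨y u _)) (y≤x∨y u _)
                       (∨-least (<⇒≤ u<x) (<⇒≤ (below j)))))

    joinsBelow-covers : ExcludedMiddle 0ℓ → ∀ y → y < x → ∃[ i ] JoinsBelow x (family i) y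
    joinsBelow-covers em y y<x with ¬∀⟶∃¬ k (λ i → y ∨ family i ≈ x) (λ _ → em) (maximal ∘ independent-cons A y<x)
    ... | i , y∨aᵢ≉x = i , ≤∧≉⇒< (∨-least (<⇒≤ y<x) (<⇒≤ (below i))) y∨aᵢ≉x

    maximal-independent⇒lowerCovering : ExcludedMiddle 0ℓ → IsLowerCovering P x k (JoinsBelow x ∘ family)
    maximal-independent⇒lowerCovering em =
        (λ i → (family i , joinsBelow-self (below i)) , joinsBelow-downward , joinsBelow-∨-closed i)
      , λ y → joinsBelow-covers em y , λ (_ , y∨aᵢ<x) → ≤-<-trans (x≤x∨y _ _) y∨aᵢ<x

proposition3p2 : ExcludedMiddle 0ℓ → (P : JoinSemilattice 0ℓ 0ℓ 0ℓ) → (n : ℕ) →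
    ((∀ x → HasLowerCoveringOfSize≤ P n x) ⇔ KTop-free P (suc n))
proposition3p2 em P n = mk⇔ covered⇒free free⇒covered
  where
  covered⇒free : (∀ x → HasLowerCoveringOfSize≤ P n x) → KTop-free P (suc n)
  covered⇒free covered embedding with joinEmbedding⇒independent P embedding
  ... | x , A with covered x
  ...   | m , m≤n , _ , covering = <⇒≱ (independent≤lowerCovering P covering A) m≤n

  free⇒covered : KTop-free P (suc n) → ∀ x → HasLowerCoveringOfSize≤ P n x
  free⇒covered free x with threshold (λ _ → em) (independent-empty P) (free ∘ independent⇒joinEmbedding P)
  ... | k , k≤n , A , maximal = k , k≤n , _ , maximal-independent⇒lowerCovering P A maximal em
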